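{- Let $\mathbb{F}$ be a sufficiently large field and let $P(x_1,\dots,x_n,y)\in\mathbb{F}[x_1,\dots,x_n,y]$ be computed by a staggered arithmetic circuit of width $w$ and size $s$, where the maximum degree of $y$ in $P$ is $r$. Then for each $j$, the $j$-th partial derivative $\partial^j P/\partial y^j$ can be computed by a staggered circuit of width $w+O(1)$ and size $(rs)^{O(1)}$.
   Context: Polynomials are commutative. An arithmetic circuit has leaves labeled by variables or field constants and internal $+$/$\times$ gates of indegree two; it is layered if its nodes are partitioned into layers $V_1,\dots,V_t$, $V_1$ leaves, children of nodes in $V_i$ ($i>1$) in $V_1\cup V_{i-1}$; size is the number of nodes, width is $\max_{i>1}|V_i|$. A layered circuit is staggered if in each layer $i>1$ every node except possibly one is a product gate $g=u\times 1$ for a gate $u$ of the previous layer. -}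

module Defs where

open import Level using (Level; _⊔_) renaming (suc to lsuc)
open import Data.Nat using (ℕ; zero; suc)
  renaming (_⊔_ to max)
open import Data.Fin using (Fin; fromℕ)
  renaming (zero to fzero; suc to fsuc)
open import Data.Vec using (Vec; []; _∷_; lookup; map)
open import Data.Sum using (_⊎_; inj₁; inj₂)
open import Data.Product using (Σ; ∃; _×_; _,_)
open import Relation.Nullary using (¬_)
open import Relation.Binary.PropositionalEquality using (_≡_)
open import Algebra.Bundles using (CommutativeRing)
import Data.Fin
import Data.Nat
import Data.Empty.Polymorphic
import Data.Unit.Polymorphic

record Field (c ℓ : Level) : Set (lsuc (c ⊔ ℓ)) where
  field
    ring : CommutativeRing c ℓ
  open CommutativeRing ring public hiding (ring)
  field
    1≉0 : ¬ (1# ≈ 0#)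
    inverse : ∀ x → ¬ (x ≈ 0#) → Σ Carrier λ y → (x * y) ≈ 1#

HasAtLeast : ∀ {c ℓ} → Field c ℓ → ℕ → Set (c ⊔ ℓ)
HasAtLeast F N = Σ (Fin N → Carrier) λ f → ∀ i j → f i ≈ f j → i ≡ j
  where open Field F

-- Polynomials in F[x_1..x_n, y]: expressions modulo the axioms of a
-- commutative F-algebra (i.e. the free commutative F-algebra on the
-- variables x_1..x_n, y, which is the polynomial ring).

module Poly {c ℓ} (F : Field c ℓ) (n : ℕ) where
  open Field F using (Carrier; _≈_; 0#; 1#; -_) renaming (_+_ to _+F_; _*_ to _*F_)

  data Expr : Set c where
    xv  : Fin n → Expr
    yv  : Expr
    cst : Carrier → Expr
    _⊕_ : Expr → Expr → Expr
    _⊗_ : Expr → Expr → Expr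

  infixl 6 _⊕_
  infixl 7 _⊗_
  infix 4 _≈P_

  data _≈P_ : Expr → Expr → Set (c ⊔ ℓ) where
    ≈-refl  : ∀ {a} → a ≈P a
    ≈-sym   : ∀ {a b} → a ≈P b → b ≈P a
    ≈-trans : ∀ {a b d} → a ≈P b → b ≈P d → a ≈P d
    ⊕-cong  : ∀ {a b a' b'} → a ≈P a' → b ≈P b' → a ⊕ b ≈P a' ⊕ b'
    ⊗-cong  : ∀ {a b a' b'} → a ≈P a' → b ≈P b' → a ⊗ b ≈P a' ⊗ b'
    ⊕-assoc : ∀ a b d → (a ⊕ b) ⊕ d ≈P a ⊕ (b ⊕ d)
    ⊕-comm  : ∀ a b → a ⊕ b ≈P b ⊕ a
    ⊕-idˡ   : ∀ a → cst 0# ⊕ a ≈P a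
    ⊕-invˡ  : ∀ a → cst (- 1#) ⊗ a ⊕ a ≈P cst 0#
    ⊗-assoc : ∀ a b d → (a ⊗ b) ⊗ d ≈P a ⊗ (b ⊗ d)
    ⊗-comm  : ∀ a b → a ⊗ b ≈P b ⊗ a
    ⊗-idˡ   : ∀ a → cst 1# ⊗ a ≈P a
    distribˡ : ∀ a b d → a ⊗ (b ⊕ d) ≈P a ⊗ b ⊕ a ⊗ d
    cst-cong : ∀ {u v} → u ≈ v → cst u ≈P cst v
    cst-+   : ∀ u v → cst u ⊕ cst v ≈P cst (u +F v)
    cst-*   : ∀ u v → cst u ⊗ cst v ≈P cst (u *F v)

  ∂y : Expr → Expr
  ∂y (xv i)  = cst 0#
  ∂y yv      = cst 1#
  ∂y (cst u) = cst 0#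
  ∂y (a ⊕ b) = ∂y a ⊕ ∂y b
  ∂y (a ⊗ b) = ∂y a ⊗ b ⊕ a ⊗ ∂y b

  ∂y^ : ℕ → Expr → Expr
  ∂y^ zero    e = e
  ∂y^ (suc j) e = ∂y (∂y^ j e)

  data YFree : Expr → Set c where
    xv  : ∀ i → YFree (xv i)
    cst : ∀ u → YFree (cst u)
    _⊕_ : ∀ {a b} → YFree a → YFree b → YFree (a ⊕ b)
    _⊗_ : ∀ {a b} → YFree a → YFree b → YFree (a ⊗ b)

  yPow : ℕ → Expr
  yPow zero    = cst 1#
  yPow (suc k) = yPow k ⊗ yv

  ySum : (r : ℕ) → (Fin (suc r) → Expr) → Expr
  ySum zero    co = co fzero ⊗ yPow zero
  ySum (suc r) co = co (fromℕ (suc r)) ⊗ yPow (suc r)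
                    ⊕ ySum r (λ k → co (Data.Fin.inject₁ k))

  DegY : Expr → ℕ → Set (c ⊔ ℓ)
  DegY P r = Σ (Fin (suc r) → Expr) λ co →
               (∀ k → YFree (co k))
             × (P ≈P ySum r co)
             × ¬ (co (fromℕ r) ≈P cst 0#)

  data Leaf : Set c where
    xleaf : Fin n → Leaf
    yleaf : Leaf
    cleaf : Carrier → Leaf

  data Op : Set where
    plus times : Op

  -- A gate in a layer i > 1; m = |V_1| (leaves), k = |V_{i-1}|.
  -- A child is either a leaf (inj₁) or a node of the previous layer (inj₂).
  -- (For i = 2 the previous layer is V_1 itself, so k = m.)
  record Gate (m k : ℕ) : Set where
    constructor gate
    field
      op    : Op
      left  : Fin m ⊎ Fin k
      right : Fin m ⊎ Fin k

  -- Layers V_2, V_3, ..., given the size k of the preceding layer.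
  data Layers (m : ℕ) : ℕ → Set where
    []  : ∀ {k} → Layers m k
    _∷_ : ∀ {k k'} → Vec (Gate m k) k' → Layers m k' → Layers m k

  record Circuit : Set c where
    constructor circuit
    field
      m      : ℕ
      leaves : Vec Leaf m
      layers : Layers m m

  layersSize : ∀ {m k} → Layers m k → ℕ
  layersSize []       = 0
  layersSize (_∷_ {k' = k'} g ls) = k' Data.Nat.+ layersSize ls

  size : Circuit → ℕ
  size C = Circuit.m C Data.Nat.+ layersSize (Circuit.layers C)

  layersWidth : ∀ {m k} → Layers m k → ℕ
  layersWidth []       = 0
  layersWidth (_∷_ {k' = k'} g ls) = max k' (layersWidth ls)

  width : Circuit → ℕ
  width C = layersWidth (Circuit.layers C)

  leafExpr : Leaf → Expr
  leafExpr (xleaf i) = xv i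
  leafExpr yleaf     = yv
  leafExpr (cleaf u) = cst u

  child : ∀ {m k} → Vec Expr m → Vec Expr k → Fin m ⊎ Fin k → Expr
  child ls prev (inj₁ i) = lookup ls i
  child ls prev (inj₂ i) = lookup prev i

  gateExpr : ∀ {m k} → Vec Expr m → Vec Expr k → Gate m k → Expr
  gateExpr ls prev (gate plus  l r) = child ls prev l ⊕ child ls prev r
  gateExpr ls prev (gate times l r) = child ls prev l ⊗ child ls prev r

  LayersCompute : ∀ {m k} → Vec Expr m → Vec Expr k → Layers m k → Expr → Set (c ⊔ ℓ)
  LayersCompute ls prev []       P = Data.Empty.Polymorphic.⊥
  LayersCompute ls prev (g ∷ gs) P =
    let vals = map (gateExpr ls prev) g in
    (Σ (Fin _) λ i → lookup vals i ≈P P) ⊎ LayersCompute ls vals gs P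

  Computes : Circuit → Expr → Set (c ⊔ ℓ)
  Computes (circuit m lv ls) P =
    let vals = map leafExpr lv in
    (Σ (Fin m) λ i → lookup vals i ≈P P) ⊎ LayersCompute vals vals ls P

  IsOneLeaf : ∀ {m} → Vec Leaf m → Fin m → Set (c ⊔ ℓ)
  IsOneLeaf lv i = Σ Carrier λ u → (lookup lv i ≡ cleaf u) × (u ≈ 1#)

  IsCopy : ∀ {m k} → Vec Leaf m → Gate m k → Set (c ⊔ ℓ)
  IsCopy lv g =
    (Gate.op g ≡ times) ×
    ( (Σ (Fin _) λ u → Σ (Fin _) λ i →
         (Gate.left g ≡ inj₂ u) × (Gate.right g ≡ inj₁ i) × IsOneLeaf lv i)
    ⊎ (Σ (Fin _) λ u → Σ (Fin _) λ i →
         (Gate.right g ≡ inj₂ u) × (Gate.left g ≡ inj₁ i) × IsOneLeaf lv i))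

  StaggeredLayers : ∀ {m k} → Vec Leaf m → Layers m k → Set (c ⊔ ℓ)
  StaggeredLayers lv []       = Data.Unit.Polymorphic.⊤
  StaggeredLayers lv (g ∷ gs) =
    (∀ i j → ¬ IsCopy lv (lookup g i) → ¬ IsCopy lv (lookup g j) → i ≡ j)
    × StaggeredLayers lv gs

  Staggered : Circuit → Set (c ⊔ ℓ)
  Staggered (circuit m lv ls) = StaggeredLayers lv ls

module Submission where

-- Over a field, r + 1 distinct points α₀, …, α_r give coefficients μᵢ with
-- ∂ʲP/∂yʲ = Σᵢ μᵢ P(x, y + αᵢ) whenever deg_y P ≤ r: expanding (y + αᵢ)ᵏ shows that this
-- holds for every monomial yᵏ, k ≤ r, exactly when Σᵢ μᵢ αᵢᵉ = j!·[e = j] for all e ≤ r, a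
-- transposed Vandermonde system. Each shift P(x, y + αᵢ) is computed by replaying the staggered
-- circuit for P with y read from a node carrying y + αᵢ, next to copies of that node and of a
-- running sum; doing the r + 1 replays one after another keeps the width at w + 2 and makes the
-- size O(r · s · w).

open import Defs
open import Data.Nat using (ℕ)
open import Data.Fin using (Fin)
open import Data.Vec using (Vec)

module Vandermonde {c ℓ} (F : Field c ℓ) where

  open import Data.Nat using (ℕ; zero; suc; _≤_; z≤n; s≤s)
  open import Data.Nat.Properties using (m≤n⇒m≤1+n)
  open import Data.Fin using (Fin; zero; suc)
  open import Data.Fin.Properties using (suc-injective)
  open import Data.Product using (Σ; _,_; proj₁; proj₂)
  open import Function using (_∘_)
  open import Relation.Nullary using (¬_)
  open import Relation.Binary.PropositionalEquality using (_≡_)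

  open Field F hiding (zero)
  open import Algebra.Properties.Semiring.Exp semiring using (_^_)
  open import Algebra.Properties.Semiring.Sum semiring using (sum; sum-cong-≋; sum-replicate-zero; ∑-distrib-+; *-distribˡ-sum)
  open import Algebra.Properties.Group +-group using (x∙y⁻¹≈ε⇒x≈y)
  open import Algebra.Solver.Ring.NaturalCoefficients.Default commutativeSemiring
    using (solve; _:=_; _:+_; _:*_)
  open import Relation.Binary.Reasoning.Setoid setoid

  vandermonde-solvable :
    ∀ r (α : Fin (suc r) → Carrier) → (∀ i k → α i ≈ α k → i ≡ k) → (t : ℕ → Carrier) →
    Σ (Fin (suc r) → Carrier) λ μ → ∀ e → e ≤ r → sum (λ i → μ i * α i ^ e) ≈ t e
  vandermonde-solvable zero α _ t = (λ _ → t 0) , λ { zero z≤n → trans (+-identityʳ _) (*-identityʳ _) }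
  vandermonde-solvable (suc r) α distinct t = μ , moments
    where
    p : Carrier
    p = α zero

    β : Fin (suc r) → Carrier
    β = α ∘ suc

    d : Fin (suc r) → Carrier
    d i = β i - p

    d≉0 : ∀ i → ¬ (d i ≈ 0#)
    d≉0 i d≈0 with distinct (suc i) zero (x∙y⁻¹≈ε⇒x≈y (β i) p d≈0)
    ... | ()

    d⁻¹ : Fin (suc r) → Carrier
    d⁻¹ i = proj₁ (inverse (d i) (d≉0 i))

    d*d⁻¹≈1 : ∀ i → d i * d⁻¹ i ≈ 1#
    d*d⁻¹≈1 i = proj₂ (inverse (d i) (d≉0 i))

    -- Eliminating p from the last r + 1 equations leaves a system for the nodes β with
    -- right-hand side t (e + 1) - p t e; its solution ν is rescaled by 1 / (β i - p).
    reduced : Σ (Fin (suc r) → Carrier) λ ν → ∀ e → e ≤ r → sum (λ i → ν i * β i ^ e) ≈ t (suc e) - p * t e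
    reduced = vandermonde-solvable r β (λ i k → suc-injective ∘ distinct (suc i) (suc k)) (λ e → t (suc e) - p * t e)

    ν : Fin (suc r) → Carrier
    ν = proj₁ reduced

    μ : Fin (suc (suc r)) → Carrier
    μ zero    = t 0 - sum (λ i → ν i * d⁻¹ i)
    μ (suc i) = ν i * d⁻¹ i

    -- q i e = (β i ^ e - p ^ e) / (β i - p)
    q : Fin (suc r) → ℕ → Carrier
    q i zero    = 0#
    q i (suc e) = p * q i e + β i ^ e

    β^≈p^+d*q : ∀ i e → β i ^ e ≈ p ^ e + d i * q i e
    β^≈p^+d*q i zero = sym (trans (+-congˡ (zeroʳ (d i))) (+-identityʳ 1#))
    β^≈p^+d*q i (suc e) = begin
      β i * β i ^ e                            ≈⟨ *-congʳ β≈p+d ⟩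
      (p + d i) * β i ^ e                      ≈⟨ *-congˡ (β^≈p^+d*q i e) ⟩
      (p + d i) * (p ^ e + d i * q i e)        ≈⟨ solve 4 (λ p d pe qe → (p :+ d) :* (pe :+ d :* qe)
                                                     := p :* pe :+ d :* (p :* qe :+ (pe :+ d :* qe)))
                                                   refl p (d i) (p ^ e) (q i e) ⟩
      p * p ^ e + d i * (p * q i e + (p ^ e + d i * q i e)) ≈⟨ +-congˡ (*-congˡ (+-congˡ (sym (β^≈p^+d*q i e)))) ⟩
      p * p ^ e + d i * q i (suc e)            ∎
      where
      β≈p+d : β i ≈ p + d i
      β≈p+d = sym (begin
        p + (β i - p)  ≈⟨ solve 3 (λ p b np → p :+ (b :+ np) := b :+ (p :+ np)) refl p (β i) (- p) ⟩
        β i + (p - p)  ≈⟨ +-congˡ (-‿inverseʳ p) ⟩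
        β i + 0#       ≈⟨ +-identityʳ (β i) ⟩
        β i            ∎)

    Q : ℕ → Carrier
    Q e = sum (λ i → ν i * q i e)

    Q+p^*t0≈t : ∀ e → e ≤ suc r → Q e + p ^ e * t 0 ≈ t e
    Q+p^*t0≈t zero _ = begin
      sum (λ i → ν i * 0#) + 1# * t 0 ≈⟨ +-cong (sum-cong-≋ {suc r} (λ i → zeroʳ (ν i))) (*-identityˡ (t 0)) ⟩
      sum {suc r} (λ _ → 0#) + t 0   ≈⟨ +-congʳ (sum-replicate-zero (suc r)) ⟩
      0# + t 0                       ≈⟨ +-identityˡ (t 0) ⟩
      t 0                            ∎
    Q+p^*t0≈t (suc e) (s≤s e≤r) = begin
      Q (suc e) + p * p ^ e * t 0
        ≈⟨ +-congʳ (trans (sum-cong-≋ {suc r} (λ i → distribˡ (ν i) (p * q i e) (β i ^ e)))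
                         (∑-distrib-+ (λ i → ν i * (p * q i e)) (λ i → ν i * β i ^ e))) ⟩
      (sum (λ i → ν i * (p * q i e)) + sum (λ i → ν i * β i ^ e)) + p * p ^ e * t 0
        ≈⟨ +-congʳ (+-cong (trans (sum-cong-≋ {suc r} (λ i → x*[y*z]≈y*[x*z] (ν i) p (q i e)))
                                  (sym (*-distribˡ-sum p (λ i → ν i * q i e))))
                           (proj₂ reduced e e≤r)) ⟩
      (p * Q e + (t (suc e) - p * t e)) + p * p ^ e * t 0
        ≈⟨ solve 5 (λ p Q s pe t0 → (p :* Q :+ s) :+ p :* pe :* t0 := p :* (Q :+ pe :* t0) :+ s)
                   refl p (Q e) (t (suc e) - p * t e) (p ^ e) (t 0) ⟩
      p * (Q e + p ^ e * t 0) + (t (suc e) - p * t e)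
        ≈⟨ +-congʳ (*-congˡ (Q+p^*t0≈t e (m≤n⇒m≤1+n e≤r))) ⟩
      p * t e + (t (suc e) - p * t e)
        ≈⟨ solve 3 (λ a b c → a :+ (b :+ c) := b :+ (a :+ c)) refl (p * t e) (t (suc e)) _ ⟩
      t (suc e) + (p * t e - p * t e)
        ≈⟨ trans (+-congˡ (-‿inverseʳ _)) (+-identityʳ _) ⟩
      t (suc e) ∎
      where
      x*[y*z]≈y*[x*z] : ∀ x y z → x * (y * z) ≈ y * (x * z)
      x*[y*z]≈y*[x*z] = solve 3 (λ x y z → x :* (y :* z) := y :* (x :* z)) refl

    moments : ∀ e → e ≤ suc r → sum (λ i → μ i * α i ^ e) ≈ t e
    moments e e≤ = begin
      μ zero * p ^ e + sum (λ i → ν i * d⁻¹ i * β i ^ e)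
        ≈⟨ +-congˡ (trans (sum-cong-≋ {suc r} split)
                          (∑-distrib-+ (λ i → p ^ e * (ν i * d⁻¹ i)) (λ i → ν i * q i e))) ⟩
      μ zero * p ^ e + (sum (λ i → p ^ e * (ν i * d⁻¹ i)) + Q e)
        ≈⟨ +-congˡ (+-congʳ (sym (*-distribˡ-sum (p ^ e) (λ i → ν i * d⁻¹ i)))) ⟩
      (t 0 - S) * p ^ e + (p ^ e * S + Q e)
        ≈⟨ solve 5 (λ t0 nS pe S Q → (t0 :+ nS) :* pe :+ (pe :* S :+ Q) := (Q :+ pe :* t0) :+ pe :* (S :+ nS))
                   refl (t 0) (- S) (p ^ e) S (Q e) ⟩
      (Q e + p ^ e * t 0) + p ^ e * (S - S)
        ≈⟨ +-cong (Q+p^*t0≈t e e≤) (trans (*-congˡ (-‿inverseʳ S)) (zeroʳ _)) ⟩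
      t e + 0#
        ≈⟨ +-identityʳ (t e) ⟩
      t e ∎
      where
      S : Carrier
      S = sum (λ i → ν i * d⁻¹ i)
      split : ∀ i → ν i * d⁻¹ i * β i ^ e ≈ p ^ e * (ν i * d⁻¹ i) + ν i * q i e
      split i = begin
        ν i * d⁻¹ i * β i ^ e                     ≈⟨ *-congˡ (β^≈p^+d*q i e) ⟩
        ν i * d⁻¹ i * (p ^ e + d i * q i e)       ≈⟨ solve 5 (λ v w pe d q → v :* w :* (pe :+ d :* q)
                                                       := pe :* (v :* w) :+ (v :* q) :* (d :* w))
                                                     refl (ν i) (d⁻¹ i) (p ^ e) (d i) (q i e) ⟩
        p ^ e * (ν i * d⁻¹ i) + (ν i * q i e) * (d i * d⁻¹ i)
          ≈⟨ +-congˡ (trans (*-congˡ (d*d⁻¹≈1 i)) (*-identityʳ _)) ⟩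
        p ^ e * (ν i * d⁻¹ i) + ν i * q i e ∎


module Expressions {c ℓ} (F : Field c ℓ) (n : ℕ) where

  open import Level using (_⊔_)
  open import Data.Product using (_,_)
  open import Relation.Binary.PropositionalEquality as ≡ using (_≡_)
  open import Relation.Binary.Structures using (IsEquivalence)
  open import Algebra.Bundles using (CommutativeSemiring)
  open import Algebra.Structures.Biased using (IsCommutativeSemiringˡ)
  open import Algebra.Structures using (IsCommutativeMonoid)

  private module F = Field F
  open F using (0#; 1#)
  open Poly F n

  ≈P-isEquivalence : IsEquivalence _≈P_
  ≈P-isEquivalence = record { refl = ≈-refl ; sym = ≈-sym ; trans = ≈-trans }

  ≡⇒≈P : ∀ {a b} → a ≡ b → a ≈P b
  ≡⇒≈P ≡.refl = ≈-refl

  ⊕-identityʳ : ∀ a → a ⊕ cst 0# ≈P a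
  ⊕-identityʳ a = ≈-trans (⊕-comm a (cst 0#)) (⊕-idˡ a)

  ⊗-identityʳ : ∀ a → a ⊗ cst 1# ≈P a
  ⊗-identityʳ a = ≈-trans (⊗-comm a (cst 1#)) (⊗-idˡ a)

  ⊗-distribʳ : ∀ a b d → (b ⊕ d) ⊗ a ≈P b ⊗ a ⊕ d ⊗ a
  ⊗-distribʳ a b d =
    ≈-trans (⊗-comm (b ⊕ d) a) (≈-trans (distribˡ a b d) (⊕-cong (⊗-comm a b) (⊗-comm a d)))

  -- Only additive inverses are axioms: cancel -1 · (0 · a) from 0 · a + 0 · a ≈ (0 + 0) · a.
  ⊗-zeroˡ : ∀ a → cst 0# ⊗ a ≈P cst 0#
  ⊗-zeroˡ a =
    ≈-trans (≈-sym (⊕-idˡ z))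
    (≈-trans (⊕-cong (≈-sym (⊕-invˡ z)) ≈-refl)
    (≈-trans (⊕-assoc _ z z)
    (≈-trans (⊕-cong ≈-refl (≈-trans (≈-sym (⊗-distribʳ a (cst 0#) (cst 0#)))
                                       (⊗-cong (≈-trans (cst-+ 0# 0#) (cst-cong (F.+-identityˡ 0#))) ≈-refl)))
    (⊕-invˡ z))))
    where
    z : Expr
    z = cst 0# ⊗ a

  isCommutativeMonoid-⊕ : IsCommutativeMonoid _≈P_ _⊕_ (cst 0#)
  isCommutativeMonoid-⊕ = record
    { isMonoid = record
      { isSemigroup = record
        { isMagma = record { isEquivalence = ≈P-isEquivalence ; ∙-cong = ⊕-cong }
        ; assoc = ⊕-assoc }
      ; identity = ⊕-idˡ , ⊕-identityʳ }
    ; comm = ⊕-comm }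

  isCommutativeMonoid-⊗ : IsCommutativeMonoid _≈P_ _⊗_ (cst 1#)
  isCommutativeMonoid-⊗ = record
    { isMonoid = record
      { isSemigroup = record
        { isMagma = record { isEquivalence = ≈P-isEquivalence ; ∙-cong = ⊗-cong }
        ; assoc = ⊗-assoc }
      ; identity = ⊗-idˡ , ⊗-identityʳ }
    ; comm = ⊗-comm }

  commutativeSemiring : CommutativeSemiring c (c ⊔ ℓ)
  commutativeSemiring = record
    { isCommutativeSemiring = IsCommutativeSemiringˡ.isCommutativeSemiring (record
        { +-isCommutativeMonoid = isCommutativeMonoid-⊕
        ; *-isCommutativeMonoid = isCommutativeMonoid-⊗
        ; distribʳ = ⊗-distribʳ
        ; zeroˡ = ⊗-zeroˡ }) }


module Derivatives {c ℓ} (F : Field c ℓ) (n : ℕ) where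

  open import Level using (_⊔_)
  open import Data.Nat using (zero; suc; _+_; _∸_; _≤_; z≤n)
  open import Data.Nat.Properties using (≤-refl; ≤-trans; m≤n⇒m≤1+n; n≤1+n; +-suc; +-identityʳ; ∸-+-assoc; +-comm)
  open import Data.Fin using (Fin; fromℕ; inject₁) renaming (zero to fzero)
  open import Data.Product using (_,_)
  open import Function using (_∘_)
  open import Relation.Binary.PropositionalEquality as ≡ using (_≡_)
  open import Algebra.Bundles using (CommutativeSemiring)
  import Algebra.Properties.Semiring.Sum

  private module F = Field F
  open F using (Carrier; 0#; 1#)
  open Poly F n
  open Expressions F n
  open import Algebra.Properties.Semiring.Exp F.semiring using (_^_)
  open import Algebra.Properties.Semiring.Mult F.semiring using (_×_)
  private
    module ΣF = Algebra.Properties.Semiring.Sum F.semiring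
    module ΣE = Algebra.Properties.Semiring.Sum (CommutativeSemiring.semiring commutativeSemiring)
  open import Algebra.Solver.Ring.NaturalCoefficients.Default commutativeSemiring
    using (solve; _:=_; _:+_; _:*_; con)
  open import Relation.Binary.Reasoning.Setoid (CommutativeSemiring.setoid commutativeSemiring)

  shift : Carrier → Expr → Expr
  shift α (xv i)  = xv i
  shift α yv      = yv ⊕ cst α
  shift α (cst u) = cst u
  shift α (a ⊕ b) = shift α a ⊕ shift α b
  shift α (a ⊗ b) = shift α a ⊗ shift α b

  shift-cong : ∀ α {a b} → a ≈P b → shift α a ≈P shift α b
  shift-cong α ≈-refl           = ≈-refl
  shift-cong α (≈-sym p)        = ≈-sym (shift-cong α p)
  shift-cong α (≈-trans p q)    = ≈-trans (shift-cong α p) (shift-cong α q)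
  shift-cong α (⊕-cong p q)     = ⊕-cong (shift-cong α p) (shift-cong α q)
  shift-cong α (⊗-cong p q)     = ⊗-cong (shift-cong α p) (shift-cong α q)
  shift-cong α (⊕-assoc a b d)  = ⊕-assoc _ _ _
  shift-cong α (⊕-comm a b)     = ⊕-comm _ _
  shift-cong α (⊕-idˡ a)        = ⊕-idˡ _
  shift-cong α (⊕-invˡ a)       = ⊕-invˡ _
  shift-cong α (⊗-assoc a b d)  = ⊗-assoc _ _ _
  shift-cong α (⊗-comm a b)     = ⊗-comm _ _
  shift-cong α (⊗-idˡ a)        = ⊗-idˡ _
  shift-cong α (distribˡ a b d) = distribˡ _ _ _
  shift-cong α (cst-cong p)     = cst-cong p
  shift-cong α (cst-+ u v)      = cst-+ u v
  shift-cong α (cst-* u v)      = cst-* u v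

  shift-yFree : ∀ α {a} → YFree a → shift α a ≡ a
  shift-yFree α (xv i)  = ≡.refl
  shift-yFree α (cst u) = ≡.refl
  shift-yFree α (p ⊕ q) = ≡.cong₂ _⊕_ (shift-yFree α p) (shift-yFree α q)
  shift-yFree α (p ⊗ q) = ≡.cong₂ _⊗_ (shift-yFree α p) (shift-yFree α q)

  ∂y-cong : ∀ {a b} → a ≈P b → ∂y a ≈P ∂y b
  ∂y-cong ≈-refl           = ≈-refl
  ∂y-cong (≈-sym p)        = ≈-sym (∂y-cong p)
  ∂y-cong (≈-trans p q)    = ≈-trans (∂y-cong p) (∂y-cong q)
  ∂y-cong (⊕-cong p q)     = ⊕-cong (∂y-cong p) (∂y-cong q)
  ∂y-cong (⊗-cong p q)     = ⊕-cong (⊗-cong (∂y-cong p) q) (⊗-cong p (∂y-cong q))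
  ∂y-cong (⊕-assoc a b d)  = ⊕-assoc _ _ _
  ∂y-cong (⊕-comm a b)     = ⊕-comm _ _
  ∂y-cong (⊕-idˡ a)        = ⊕-idˡ _
  ∂y-cong (⊕-invˡ a)       =
    ≈-trans (⊕-cong (≈-trans (⊕-cong (⊗-zeroˡ a) ≈-refl) (⊕-idˡ _)) ≈-refl) (⊕-invˡ (∂y a))
  ∂y-cong (⊗-assoc a b d)  =
    solve 6 (λ a b d a′ b′ d′ → (a′ :* b :+ a :* b′) :* d :+ (a :* b) :* d′
                                := a′ :* (b :* d) :+ a :* (b′ :* d :+ b :* d′))
            ≈-refl a b d (∂y a) (∂y b) (∂y d)
  ∂y-cong (⊗-comm a b)     =
    solve 4 (λ a b a′ b′ → a′ :* b :+ a :* b′ := b′ :* a :+ b :* a′) ≈-refl a b (∂y a) (∂y b)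
  ∂y-cong (⊗-idˡ a)        = solve 2 (λ a a′ → con 0 :* a :+ con 1 :* a′ := a′) ≈-refl a (∂y a)
  ∂y-cong (distribˡ a b d) =
    solve 6 (λ a b d a′ b′ d′ → a′ :* (b :+ d) :+ a :* (b′ :+ d′)
                                := (a′ :* b :+ a :* b′) :+ (a′ :* d :+ a :* d′))
            ≈-refl a b d (∂y a) (∂y b) (∂y d)
  ∂y-cong (cst-cong p)     = ≈-refl
  ∂y-cong (cst-+ u v)      = ⊕-idˡ _
  ∂y-cong (cst-* u v)      = solve 2 (λ a b → con 0 :* b :+ a :* con 0 := con 0) ≈-refl (cst u) (cst v)

  ∂y-yFree : ∀ {a} → YFree a → ∂y a ≈P cst 0#
  ∂y-yFree (xv i)  = ≈-refl
  ∂y-yFree (cst u) = ≈-refl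
  ∂y-yFree (p ⊕ q) = ≈-trans (⊕-cong (∂y-yFree p) (∂y-yFree q)) (⊕-idˡ _)
  ∂y-yFree {a ⊗ b} (p ⊗ q) =
    ≈-trans (⊕-cong (⊗-cong (∂y-yFree p) ≈-refl) (⊗-cong ≈-refl (∂y-yFree q)))
            (solve 2 (λ a b → con 0 :* b :+ a :* con 0 := con 0) ≈-refl a b)

  record IsYFreeLinear (Φ : Expr → Expr) : Set (c ⊔ ℓ) where
    field
      cong   : ∀ {a b} → a ≈P b → Φ a ≈P Φ b
      ⊕-hom  : ∀ a b → Φ (a ⊕ b) ≈P Φ a ⊕ Φ b
      scalar : ∀ {a} → YFree a → ∀ f → Φ (a ⊗ f) ≈P a ⊗ Φ f

  scalar-ext : ∀ {Φ Ψ} → IsYFreeLinear Φ → IsYFreeLinear Ψ → ∀ {a} → YFree a → ∀ f →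
               Φ f ≈P Ψ f → Φ (a ⊗ f) ≈P Ψ (a ⊗ f)
  scalar-ext {Φ} {Ψ} Φ-lin Ψ-lin {a} a-free f Φf≈Ψf = begin
    Φ (a ⊗ f)  ≈⟨ IsYFreeLinear.scalar Φ-lin a-free f ⟩
    a ⊗ Φ f    ≈⟨ ⊗-cong ≈-refl Φf≈Ψf ⟩
    a ⊗ Ψ f    ≈⟨ ≈-sym (IsYFreeLinear.scalar Ψ-lin a-free f) ⟩
    Ψ (a ⊗ f)  ∎

  ySum-ext : ∀ {Φ Ψ} → IsYFreeLinear Φ → IsYFreeLinear Ψ → ∀ r co → (∀ k → YFree (co k)) →
             (∀ k → k ≤ r → Φ (yPow k) ≈P Ψ (yPow k)) → Φ (ySum r co) ≈P Ψ (ySum r co)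
  ySum-ext Φ-lin Ψ-lin zero co yFree agree = scalar-ext Φ-lin Ψ-lin (yFree fzero) (yPow 0) (agree 0 z≤n)
  ySum-ext {Φ} {Ψ} Φ-lin Ψ-lin (suc r) co yFree agree = begin
    Φ (top ⊕ rest)  ≈⟨ IsYFreeLinear.⊕-hom Φ-lin top rest ⟩
    Φ top ⊕ Φ rest  ≈⟨ ⊕-cong (scalar-ext Φ-lin Ψ-lin (yFree _) (yPow (suc r)) (agree (suc r) ≤-refl))
                              (ySum-ext Φ-lin Ψ-lin r (co ∘ inject₁) (yFree ∘ inject₁)
                                        (λ k k≤r → agree k (m≤n⇒m≤1+n k≤r))) ⟩
    Ψ top ⊕ Ψ rest  ≈⟨ ≈-sym (IsYFreeLinear.⊕-hom Ψ-lin top rest) ⟩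
    Ψ (top ⊕ rest)  ∎
    where
    top rest : Expr
    top  = co (fromℕ (suc r)) ⊗ yPow (suc r)
    rest = ySum r (co ∘ inject₁)

  ∂y^-cong : ∀ j {a b} → a ≈P b → ∂y^ j a ≈P ∂y^ j b
  ∂y^-cong zero    p = p
  ∂y^-cong (suc j) p = ∂y-cong (∂y^-cong j p)

  ∂y^-isYFreeLinear : ∀ j → IsYFreeLinear (∂y^ j)
  ∂y^-isYFreeLinear j = record { cong = ∂y^-cong j ; ⊕-hom = ⊕-hom j ; scalar = scalar j }
    where
    ⊕-hom : ∀ j a b → ∂y^ j (a ⊕ b) ≈P ∂y^ j a ⊕ ∂y^ j b
    ⊕-hom zero    a b = ≈-refl
    ⊕-hom (suc j) a b = ∂y-cong (⊕-hom j a b)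

    scalar : ∀ j {a} → YFree a → ∀ f → ∂y^ j (a ⊗ f) ≈P a ⊗ ∂y^ j f
    scalar zero    a-free f = ≈-refl
    scalar (suc j) {a} a-free f = begin
      ∂y (∂y^ j (a ⊗ f))                     ≈⟨ ∂y-cong (scalar j a-free f) ⟩
      ∂y a ⊗ ∂y^ j f ⊕ a ⊗ ∂y (∂y^ j f)      ≈⟨ ⊕-cong (⊗-cong (∂y-yFree a-free) ≈-refl) ≈-refl ⟩
      cst 0# ⊗ ∂y^ j f ⊕ a ⊗ ∂y (∂y^ j f)    ≈⟨ ≈-trans (⊕-cong (⊗-zeroˡ _) ≈-refl) (⊕-idˡ _) ⟩
      a ⊗ ∂y (∂y^ j f)                       ∎

  shiftCombination : ∀ {R} → (Fin R → Carrier) → (Fin R → Carrier) → Expr → Expr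
  shiftCombination μ α P = ΣE.sum (λ i → cst (μ i) ⊗ shift (α i) P)

  shiftCombination-isYFreeLinear : ∀ {R} (μ α : Fin R → Carrier) → IsYFreeLinear (shiftCombination μ α)
  shiftCombination-isYFreeLinear {R} μ α = record
    { cong   = λ p → ΣE.sum-cong-≋ {R} (λ i → ⊗-cong ≈-refl (shift-cong (α i) p))
    ; ⊕-hom  = λ a b → ≈-trans (ΣE.sum-cong-≋ {R} (λ i → distribˡ _ _ _))
                                (ΣE.∑-distrib-+ (λ i → cst (μ i) ⊗ shift (α i) a) (λ i → cst (μ i) ⊗ shift (α i) b))
    ; scalar = scalar
    }
    where
    scalar : ∀ {a} → YFree a → ∀ f → shiftCombination μ α (a ⊗ f) ≈P a ⊗ shiftCombination μ α f
    scalar {a} a-free f = begin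
      ΣE.sum (λ i → cst (μ i) ⊗ (shift (α i) a ⊗ shift (α i) f))
        ≈⟨ ΣE.sum-cong-≋ {R} (λ i → ⊗-cong ≈-refl (⊗-cong (≡⇒≈P (shift-yFree (α i) a-free)) ≈-refl)) ⟩
      ΣE.sum (λ i → cst (μ i) ⊗ (a ⊗ shift (α i) f))
        ≈⟨ ΣE.sum-cong-≋ {R} (λ i → solve 3 (λ m a s → m :* (a :* s) := a :* (m :* s)) ≈-refl (cst (μ i)) a _) ⟩
      ΣE.sum (λ i → a ⊗ (cst (μ i) ⊗ shift (α i) f))
        ≈⟨ ≈-sym (ΣE.*-distribˡ-sum a (λ i → cst (μ i) ⊗ shift (α i) f)) ⟩
      a ⊗ shiftCombination μ α f ∎

  ∂y^-⊗yv : ∀ d f → ∂y^ d (f ⊗ yv) ≈P ∂y^ d f ⊗ yv ⊕ cst (d × 1#) ⊗ ∂y^ (d ∸ 1) f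
  ∂y^-⊗yv zero f = solve 2 (λ f y → f :* y := f :* y :+ con 0 :* f) ≈-refl f yv
  ∂y^-⊗yv (suc zero) f =
    ⊕-cong ≈-refl (≈-trans (⊗-comm f (cst 1#)) (⊗-cong (cst-cong (F.sym (F.+-identityʳ 1#))) ≈-refl))
  ∂y^-⊗yv (suc (suc d)) f = begin
    ∂y (∂y^ (suc d) (f ⊗ yv))
      ≈⟨ ∂y-cong (∂y^-⊗yv (suc d) f) ⟩
    ∂y (f″ ⊗ yv ⊕ cst k ⊗ f′)
      ≈⟨ solve 5 (λ f‴ f″ f′ y k → f‴ :* y :+ f″ :* con 1 :+ (con 0 :* f′ :+ k :* f″)
                                    := f‴ :* y :+ (con 1 :+ k) :* f″)
                 ≈-refl (∂y f″) f″ f′ yv (cst k) ⟩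
    ∂y f″ ⊗ yv ⊕ (cst 1# ⊕ cst k) ⊗ f″
      ≈⟨ ⊕-cong ≈-refl (⊗-cong (cst-+ 1# k) ≈-refl) ⟩
    ∂y f″ ⊗ yv ⊕ cst (suc (suc d) × 1#) ⊗ f″ ∎
    where
    k : Carrier
    k = suc d × 1#
    f′ f″ : Expr
    f′ = ∂y^ d f
    f″ = ∂y f′

  δ₀ : ℕ → Carrier
  δ₀ zero    = 1#
  δ₀ (suc _) = 0#

  ∂y^-one : ∀ d → ∂y^ d (cst 1#) ≈P cst (δ₀ d)
  ∂y^-one zero    = ≈-refl
  ∂y^-one (suc d) = ∂y-cong (∂y^-one d)

  fallingFactorial : ℕ → ℕ → Carrier
  fallingFactorial j zero    = 1#
  fallingFactorial j (suc e) = fallingFactorial j e F.* ((j ∸ e) × 1#)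

  -- j! if e = j and 0 otherwise: the e-th moment Σᵢ μᵢ αᵢ^e required by ∂^j.
  derivativeMoment : ℕ → ℕ → Carrier
  derivativeMoment j e = fallingFactorial j e F.* δ₀ (j ∸ e)

  -- derivativeFamily and shiftFamily below both satisfy this recurrence; the moment conditions
  -- make them agree at k = 0, and at e = 0 they are the two sides of the claim for yᵏ.
  Pascal : (ℕ → ℕ → Expr) → Set (c ⊔ ℓ)
  Pascal X = ∀ k e → X (suc k) e ≈P yv ⊗ X k e ⊕ X k (suc e)

  pascal-unique : ∀ {X Y} r → Pascal X → Pascal Y → (∀ e → e ≤ r → X 0 e ≈P Y 0 e) →
                  ∀ k e → k + e ≤ r → X k e ≈P Y k e
  pascal-unique r pX pY base zero    e e≤r = base e e≤r
  pascal-unique r pX pY base (suc k) e k+e<r =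
    ≈-trans (pX k e)
    (≈-trans (⊕-cong (⊗-cong ≈-refl (pascal-unique r pX pY base k e (≤-trans (n≤1+n _) k+e<r)))
                     (pascal-unique r pX pY base k (suc e) (≡.subst (_≤ r) (≡.sym (+-suc k e)) k+e<r)))
             (≈-sym (pY k e)))

  derivativeFamily : ℕ → ℕ → ℕ → Expr
  derivativeFamily j k e = cst (fallingFactorial j e) ⊗ ∂y^ (j ∸ e) (yPow k)

  derivativeFamily-pascal : ∀ j → Pascal (derivativeFamily j)
  derivativeFamily-pascal j k e = begin
    cst ff ⊗ ∂y^ d (yPow k ⊗ yv)
      ≈⟨ ⊗-cong ≈-refl (∂y^-⊗yv d (yPow k)) ⟩
    cst ff ⊗ (∂y^ d (yPow k) ⊗ yv ⊕ cst (d × 1#) ⊗ ∂y^ (d ∸ 1) (yPow k))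
      ≈⟨ solve 5 (λ c D y m D′ → c :* (D :* y :+ m :* D′) := y :* (c :* D) :+ (c :* m) :* D′)
                 ≈-refl (cst ff) (∂y^ d (yPow k)) yv (cst (d × 1#)) (∂y^ (d ∸ 1) (yPow k)) ⟩
    yv ⊗ derivativeFamily j k e ⊕ (cst ff ⊗ cst (d × 1#)) ⊗ ∂y^ (d ∸ 1) (yPow k)
      ≈⟨ ⊕-cong ≈-refl (⊗-cong (cst-* ff (d × 1#))
                                (≡⇒≈P (≡.cong (λ d′ → ∂y^ d′ (yPow k)) j∸e∸1≡j∸1+e))) ⟩
    yv ⊗ derivativeFamily j k e ⊕ derivativeFamily j k (suc e) ∎
    where
    ff : Carrier
    ff = fallingFactorial j e
    d : ℕ
    d = j ∸ e
    j∸e∸1≡j∸1+e : j ∸ e ∸ 1 ≡ j ∸ suc e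
    j∸e∸1≡j∸1+e = ≡.trans (∸-+-assoc j e 1) (≡.cong (j ∸_) (+-comm e 1))

  derivativeFamily-base : ∀ j e → derivativeFamily j 0 e ≈P cst (derivativeMoment j e)
  derivativeFamily-base j e =
    ≈-trans (⊗-cong ≈-refl (∂y^-one (j ∸ e))) (cst-* (fallingFactorial j e) (δ₀ (j ∸ e)))

  shiftFamily : ∀ {R} → (Fin R → Carrier) → (Fin R → Carrier) → ℕ → ℕ → Expr
  shiftFamily μ α k e = shiftCombination (λ i → μ i F.* α i ^ e) α (yPow k)

  shiftFamily-pascal : ∀ {R} (μ α : Fin R → Carrier) → Pascal (shiftFamily μ α)
  shiftFamily-pascal {R} μ α k e = begin
    ΣE.sum (λ i → cst (m i) ⊗ (Y i ⊗ (yv ⊕ cst (α i))))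
      ≈⟨ ΣE.sum-cong-≋ {R} summand ⟩
    ΣE.sum (λ i → yv ⊗ (cst (m i) ⊗ Y i) ⊕ cst (μ i F.* α i ^ suc e) ⊗ Y i)
      ≈⟨ ΣE.∑-distrib-+ (λ i → yv ⊗ (cst (m i) ⊗ Y i)) (λ i → cst (μ i F.* α i ^ suc e) ⊗ Y i) ⟩
    ΣE.sum (λ i → yv ⊗ (cst (m i) ⊗ Y i)) ⊕ shiftFamily μ α k (suc e)
      ≈⟨ ⊕-cong (≈-sym (ΣE.*-distribˡ-sum yv (λ i → cst (m i) ⊗ Y i))) ≈-refl ⟩
    yv ⊗ shiftFamily μ α k e ⊕ shiftFamily μ α k (suc e) ∎
    where
    m : Fin R → Carrier
    m i = μ i F.* α i ^ e
    Y : Fin R → Expr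
    Y i = shift (α i) (yPow k)
    x*y^e*y≈x*y^[1+e] : ∀ μ α → μ F.* α ^ e F.* α F.≈ μ F.* (α F.* α ^ e)
    x*y^e*y≈x*y^[1+e] μ α = F.trans (F.*-assoc μ _ α) (F.*-congˡ (F.*-comm (α ^ e) α))
    summand : ∀ i → cst (m i) ⊗ (Y i ⊗ (yv ⊕ cst (α i))) ≈P yv ⊗ (cst (m i) ⊗ Y i) ⊕ cst (μ i F.* α i ^ suc e) ⊗ Y i
    summand i = begin
      cst (m i) ⊗ (Y i ⊗ (yv ⊕ cst (α i)))
        ≈⟨ solve 4 (λ m Y y a → m :* (Y :* (y :+ a)) := y :* (m :* Y) :+ (m :* a) :* Y)
                   ≈-refl (cst (m i)) (Y i) yv (cst (α i)) ⟩
      yv ⊗ (cst (m i) ⊗ Y i) ⊕ (cst (m i) ⊗ cst (α i)) ⊗ Y i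
        ≈⟨ ⊕-cong ≈-refl (⊗-cong (≈-trans (cst-* (m i) (α i)) (cst-cong (x*y^e*y≈x*y^[1+e] (μ i) (α i)))) ≈-refl) ⟩
      yv ⊗ (cst (m i) ⊗ Y i) ⊕ cst (μ i F.* α i ^ suc e) ⊗ Y i ∎

  cst-sum : ∀ {R} (f : Fin R → Carrier) → ΣE.sum (λ i → cst (f i)) ≈P cst (ΣF.sum f)
  cst-sum {zero}  f = ≈-refl
  cst-sum {suc R} f = ≈-trans (⊕-cong ≈-refl (cst-sum (f ∘ Data.Fin.suc))) (cst-+ _ _)

  shiftFamily-base : ∀ {R} (μ α : Fin R → Carrier) e → shiftFamily μ α 0 e ≈P cst (ΣF.sum (λ i → μ i F.* α i ^ e))
  shiftFamily-base {R} μ α e = ≈-trans (ΣE.sum-cong-≋ {R} (λ i → ⊗-identityʳ _)) (cst-sum (λ i → μ i F.* α i ^ e))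

  Moments : ∀ {R} → (Fin R → Carrier) → (Fin R → Carrier) → ℕ → ℕ → Set ℓ
  Moments μ α j r = ∀ e → e ≤ r → ΣF.sum (λ i → μ i F.* α i ^ e) F.≈ derivativeMoment j e

  shiftCombination-yPow : ∀ {R} (μ α : Fin R → Carrier) j r → Moments μ α j r →
                          ∀ k → k ≤ r → shiftCombination μ α (yPow k) ≈P ∂y^ j (yPow k)
  shiftCombination-yPow {R} μ α j r moments k k≤r = begin
    shiftCombination μ α (yPow k)
      ≈⟨ ΣE.sum-cong-≋ {R} (λ i → ⊗-cong (cst-cong (F.sym (F.*-identityʳ (μ i)))) ≈-refl) ⟩
    shiftFamily μ α k 0
      ≈⟨ pascal-unique r (shiftFamily-pascal μ α) (derivativeFamily-pascal j) base k 0
                       (≡.subst (_≤ r) (≡.sym (+-identityʳ k)) k≤r) ⟩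
    derivativeFamily j k 0
      ≈⟨ ⊗-idˡ _ ⟩
    ∂y^ j (yPow k) ∎
    where
    base : ∀ e → e ≤ r → shiftFamily μ α 0 e ≈P derivativeFamily j 0 e
    base e e≤r = ≈-trans (shiftFamily-base μ α e)
                 (≈-trans (cst-cong (moments e e≤r)) (≈-sym (derivativeFamily-base j e)))

  shiftCombination≈∂y^ : ∀ {R} (μ α : Fin R → Carrier) j r {P} → DegY P r → Moments μ α j r →
                         shiftCombination μ α P ≈P ∂y^ j P
  shiftCombination≈∂y^ μ α j r {P} (co , yFree , P≈ySum , _) moments = begin
    shiftCombination μ α P          ≈⟨ IsYFreeLinear.cong Σ-lin P≈ySum ⟩
    shiftCombination μ α (ySum r co) ≈⟨ ySum-ext Σ-lin (∂y^-isYFreeLinear j) r co yFree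
                                                (shiftCombination-yPow μ α j r moments) ⟩
    ∂y^ j (ySum r co)               ≈⟨ ∂y^-cong j (≈-sym P≈ySum) ⟩
    ∂y^ j P                         ∎
    where
    Σ-lin : IsYFreeLinear (shiftCombination μ α)
    Σ-lin = shiftCombination-isYFreeLinear μ α


module LayeredCircuits {c ℓ} (F : Field c ℓ) (n : ℕ) where

  open import Level using (_⊔_)
  open import Data.Nat using (suc; _+_; _*_; _≤_; z≤n)
  open import Data.Nat.Properties using (≤-trans; ⊔-lub; +-mono-≤; m≤m+n; m≤n+m)
  open import Data.Fin using (zero; suc; _≟_)
  open import Data.Vec using (Vec; []; _∷_; map; lookup)
  open import Data.Product using (_×_; _,_)
  open import Data.Sum using (inj₁; inj₂)
  open import Data.Unit.Polymorphic using (⊤)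
  open import Relation.Nullary using (¬_)
  open import Relation.Nullary.Decidable using (decidable-stable)
  open import Relation.Binary.PropositionalEquality as ≡ using (_≡_; _≢_)

  open Poly F n

  StaggeredLayer : ∀ {m k k′} → Vec Leaf m → Vec (Gate m k) k′ → Set (c ⊔ ℓ)
  StaggeredLayer lv v = ∀ i j → ¬ IsCopy lv (lookup v i) → ¬ IsCopy lv (lookup v j) → i ≡ j

  staggeredLayer-copiesBut : ∀ {m k k′} (lv : Vec Leaf m) (v : Vec (Gate m k) k′) p →
                             (∀ q → q ≢ p → IsCopy lv (lookup v q)) → StaggeredLayer lv v
  staggeredLayer-copiesBut lv v p copies i j ¬copy-i ¬copy-j = ≡.trans (at-p i ¬copy-i) (≡.sym (at-p j ¬copy-j))
    where
    at-p : ∀ q → ¬ IsCopy lv (lookup v q) → q ≡ p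
    at-p q ¬copy-q = decidable-stable (q ≟ p) (λ q≢p → ¬copy-q (copies q q≢p))

  staggeredLayer-single : ∀ {m k} (lv : Vec Leaf m) (g : Gate m k) → StaggeredLayer lv (g ∷ [])
  staggeredLayer-single lv g zero zero _ _ = ≡.refl

  layersWidth≤layersSize : ∀ {m k} (ls : Layers m k) → layersWidth ls ≤ layersSize ls
  layersWidth≤layersSize []                     = z≤n
  layersWidth≤layersSize (_∷_ {k' = k′} g ls) =
    ⊔-lub (m≤m+n k′ _) (≤-trans (layersWidth≤layersSize ls) (m≤n+m _ k′))

  layersCompute⇒1≤layersSize : ∀ {m k} leaves prev (ls : Layers m k) {P} → LayersCompute leaves prev ls P → 1 ≤ layersSize ls
  layersCompute⇒1≤layersSize leaves prev (g ∷ ls) (inj₁ (zero , _))  = m≤m+n 1 _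
  layersCompute⇒1≤layersSize leaves prev (g ∷ ls) (inj₁ (suc _ , _)) = m≤m+n 1 _
  layersCompute⇒1≤layersSize leaves prev (_∷_ {k' = k′} g ls) (inj₂ lc) =
    ≤-trans (layersCompute⇒1≤layersSize leaves _ ls lc) (m≤n+m _ k′)

  computes⇒1≤size : ∀ C {P} → Computes C P → 1 ≤ size C
  computes⇒1≤size (circuit m lv ls) (inj₁ (zero , _))  = m≤m+n 1 _
  computes⇒1≤size (circuit m lv ls) (inj₁ (suc _ , _)) = m≤m+n 1 _
  computes⇒1≤size (circuit m lv ls) (inj₂ lc) = ≤-trans (layersCompute⇒1≤layersSize _ _ ls lc) (m≤n+m _ m)

  data Segment (m : ℕ) : ℕ → ℕ → Set where
    []  : ∀ {k} → Segment m k k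
    _∷_ : ∀ {k k′ k″} → Vec (Gate m k) k′ → Segment m k′ k″ → Segment m k k″

  infixr 5 _++ˢ_
  _++ˢ_ : ∀ {m k k′ k″} → Segment m k k′ → Segment m k′ k″ → Segment m k k″
  []      ++ˢ t = t
  (v ∷ s) ++ˢ t = v ∷ (s ++ˢ t)

  toLayers : ∀ {m k k′} → Segment m k k′ → Layers m k
  toLayers []      = []
  toLayers (v ∷ s) = v ∷ toLayers s

  evalˢ : ∀ {m k k′} → Vec Expr m → Vec Expr k → Segment m k k′ → Vec Expr k′
  evalˢ leaves prev []      = prev
  evalˢ leaves prev (v ∷ s) = evalˢ leaves (map (gateExpr leaves prev) v) s

  evalˢ-++ : ∀ {m k k′ k″} leaves prev (s : Segment m k k′) (t : Segment m k′ k″) →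
             evalˢ leaves prev (s ++ˢ t) ≡ evalˢ leaves (evalˢ leaves prev s) t
  evalˢ-++ leaves prev []      t = ≡.refl
  evalˢ-++ leaves prev (v ∷ s) t = evalˢ-++ leaves _ s t

  layersCompute-last : ∀ {m k k′ k″} leaves prev (v : Vec (Gate m k) k′) (s : Segment m k′ k″) P i →
    lookup (evalˢ leaves prev (v ∷ s)) i ≈P P → LayersCompute leaves prev (toLayers (v ∷ s)) P
  layersCompute-last leaves prev v []       P i h = inj₁ (i , h)
  layersCompute-last leaves prev v (v′ ∷ s) P i h = inj₂ (layersCompute-last leaves _ v′ s P i h)

  Staggeredˢ : ∀ {m k k′} → Vec Leaf m → Segment m k k′ → Set (c ⊔ ℓ)
  Staggeredˢ lv s = StaggeredLayers lv (toLayers s)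

  staggered-++ : ∀ {m k k′ k″} lv (s : Segment m k k′) (t : Segment m k′ k″) →
                 Staggeredˢ lv s → Staggeredˢ lv t → Staggeredˢ lv (s ++ˢ t)
  staggered-++ lv []      t _           st = st
  staggered-++ lv (v ∷ s) t (sv , ss) st = sv , staggered-++ lv s t ss st

  depth : ∀ {m k k′} → Segment m k k′ → ℕ
  depth []      = 0
  depth (v ∷ s) = suc (depth s)

  depth-++ : ∀ {m k k′ k″} (s : Segment m k k′) (t : Segment m k′ k″) → depth (s ++ˢ t) ≡ depth s + depth t
  depth-++ []      t = ≡.refl
  depth-++ (v ∷ s) t = ≡.cong suc (depth-++ s t)

  WidthAtMost : ∀ {m k k′} → ℕ → Segment m k k′ → Set
  WidthAtMost W []                     = ⊤
  WidthAtMost W (_∷_ {k′ = k′} v s) = k′ ≤ W × WidthAtMost W s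

  widthAtMost-++ : ∀ {m k k′ k″} W (s : Segment m k k′) (t : Segment m k′ k″) →
                   WidthAtMost W s → WidthAtMost W t → WidthAtMost W (s ++ˢ t)
  widthAtMost-++ W []      t _           wt = wt
  widthAtMost-++ W (v ∷ s) t (wv , ws) wt = wv , widthAtMost-++ W s t ws wt

  layersWidth-toLayers : ∀ {m k k′} W (s : Segment m k k′) → WidthAtMost W s → layersWidth (toLayers s) ≤ W
  layersWidth-toLayers W []      _         = z≤n
  layersWidth-toLayers W (v ∷ s) (wv , ws) = ⊔-lub wv (layersWidth-toLayers W s ws)

  layersSize-toLayers : ∀ {m k k′} W (s : Segment m k k′) → WidthAtMost W s → layersSize (toLayers s) ≤ depth s * W
  layersSize-toLayers W []      _         = z≤n
  layersSize-toLayers W (v ∷ s) (wv , ws) = +-mono-≤ wv (layersSize-toLayers W s ws)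


module ShiftCircuit {c ℓ} (F : Field c ℓ) (n : ℕ) (m : ℕ) (lv : Vec (Poly.Leaf F n) m)
                    {R : ℕ} (α μ : Fin R → Field.Carrier F) where

  open import Level using (_⊔_)
  open import Data.Nat using (zero; suc; _+_; _*_; _≤_; z≤n; s≤s)
  open import Data.Nat.Properties
    using (≤-refl; ≤-reflexive; ≤-trans; +-mono-≤; +-monoʳ-≤; *-monoˡ-≤; ⊔-lub; m≤m+n; m≤n+m; m≤m⊔n; m≤n⊔m; +-comm; +-suc)
  open import Data.Fin using (_↑ˡ_; _↑ʳ_) renaming (zero to fzero; suc to fsuc)
  open import Data.Vec using ([]; _∷_; lookup; map; tabulate; _++_)
  open import Data.Vec.Properties using (lookup-map; lookup-++ˡ; lookup-++ʳ; lookup∘tabulate)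
  open import Data.Product using (_×_; _,_; proj₁; proj₂; swap)
  open import Data.Sum using (_⊎_; inj₁; inj₂)
  open import Data.Empty using (⊥-elim)
  open import Data.Unit.Polymorphic using (⊤)
  open import Function using (_∘_)
  open import Relation.Nullary using (¬_)
  open import Relation.Binary.PropositionalEquality as ≡ using (_≡_; _≢_)
  open import Algebra.Bundles using (CommutativeSemiring)
  import Algebra.Properties.Semiring.Sum

  private module F = Field F
  open F using (Carrier; 0#; 1#)
  open Poly F n
  open Expressions F n using (≡⇒≈P; ⊗-identityʳ; ⊕-identityʳ; commutativeSemiring)
  open Derivatives F n using (shift; shift-cong; shiftCombination)
  private module ΣE = Algebra.Properties.Semiring.Sum (CommutativeSemiring.semiring commutativeSemiring)
  open LayeredCircuits F n
  open import Relation.Binary.Reasoning.Setoid (CommutativeSemiring.setoid commutativeSemiring)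

  extraLeaves : Vec Leaf (3 + (R + R))
  extraLeaves = yleaf ∷ cleaf 1# ∷ cleaf 0# ∷ (tabulate (cleaf ∘ α) ++ tabulate (cleaf ∘ μ))

  m′ : ℕ
  m′ = m + (3 + (R + R))

  lv′ : Vec Leaf m′
  lv′ = lv ++ extraLeaves

  vals : Vec Expr m
  vals = map leafExpr lv

  vals′ : Vec Expr m′
  vals′ = map leafExpr lv′

  oldLeaf : Fin m → Fin m′
  oldLeaf i = i ↑ˡ _

  yLeaf oneLeaf zeroLeaf : Fin m′
  yLeaf    = m ↑ʳ fzero
  oneLeaf  = m ↑ʳ fsuc fzero
  zeroLeaf = m ↑ʳ fsuc (fsuc fzero)

  αLeaf μLeaf : Fin R → Fin m′
  αLeaf i = m ↑ʳ fsuc (fsuc (fsuc (i ↑ˡ R)))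
  μLeaf i = m ↑ʳ fsuc (fsuc (fsuc (R ↑ʳ i)))

  lookup-oldLeaf : ∀ i → lookup lv′ (oldLeaf i) ≡ lookup lv i
  lookup-oldLeaf i = lookup-++ˡ lv extraLeaves i

  lookup-oneLeaf : lookup lv′ oneLeaf ≡ cleaf 1#
  lookup-oneLeaf = lookup-++ʳ lv extraLeaves _

  leaf′-value : ∀ {q l} → lookup lv′ q ≡ l → lookup vals′ q ≈P leafExpr l
  leaf′-value {q} eq = ≡⇒≈P (≡.trans (lookup-map q leafExpr lv′) (≡.cong leafExpr eq))

  yLeaf-value : lookup vals′ yLeaf ≈P yv
  yLeaf-value = leaf′-value (lookup-++ʳ lv extraLeaves _)

  oneLeaf-value : lookup vals′ oneLeaf ≈P cst 1#
  oneLeaf-value = leaf′-value lookup-oneLeaf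

  zeroLeaf-value : lookup vals′ zeroLeaf ≈P cst 0#
  zeroLeaf-value = leaf′-value (lookup-++ʳ lv extraLeaves _)

  αLeaf-value : ∀ i → lookup vals′ (αLeaf i) ≈P cst (α i)
  αLeaf-value i = leaf′-value (≡.trans (lookup-++ʳ lv extraLeaves _)
    (≡.trans (lookup-++ˡ (tabulate (cleaf ∘ α)) (tabulate (cleaf ∘ μ)) i) (lookup∘tabulate (cleaf ∘ α) i)))

  μLeaf-value : ∀ i → lookup vals′ (μLeaf i) ≈P cst (μ i)
  μLeaf-value i = leaf′-value (≡.trans (lookup-++ʳ lv extraLeaves _)
    (≡.trans (lookup-++ʳ (tabulate (cleaf ∘ α)) (tabulate (cleaf ∘ μ)) i) (lookup∘tabulate (cleaf ∘ μ) i)))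

  copy : ∀ {K} → Fin K → Gate m′ K
  copy u = gate times (inj₂ u) (inj₁ oneLeaf)

  copy-isCopy : ∀ {K} (u : Fin K) → IsCopy lv′ (copy u)
  copy-isCopy u = ≡.refl , inj₁ (u , oneLeaf , ≡.refl , ≡.refl , (1# , lookup-oneLeaf , F.refl))

  copy-value : ∀ {K} (st : Vec Expr K) u → gateExpr vals′ st (copy u) ≈P lookup st u
  copy-value st u = ≈-trans (⊗-cong ≈-refl oneLeaf-value) (⊗-identityʳ _)

  module Translate {K : ℕ} (yNode : Fin K) where

    translateLeaf : Leaf → Fin m → Fin m′ ⊎ Fin K
    translateLeaf yleaf     i = inj₂ yNode
    translateLeaf (xleaf _) i = inj₁ (oldLeaf i)
    translateLeaf (cleaf _) i = inj₁ (oldLeaf i)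

    translateChild : ∀ {k} → (Fin k → Fin m′ ⊎ Fin K) → Fin m ⊎ Fin k → Fin m′ ⊎ Fin K
    translateChild pr (inj₁ i) = translateLeaf (lookup lv i) i
    translateChild pr (inj₂ u) = pr u

    translateGate : ∀ {k} → (Fin k → Fin m′ ⊎ Fin K) → Gate m k → Gate m′ K
    translateGate pr (gate op l r) = gate op (translateChild pr l) (translateChild pr r)

    Realises : ∀ {k} → (Fin k → Fin m′ ⊎ Fin K) → Vec Expr K → Vec Expr k → Carrier → Set (c ⊔ ℓ)
    Realises pr st prev a = ∀ u → child vals′ st (pr u) ≈P shift a (lookup prev u)

    translateLeaf-realises : ∀ st a → lookup st yNode ≈P yv ⊕ cst a →
                             Realises (λ i → translateLeaf (lookup lv i) i) st vals a
    translateLeaf-realises st a y+a i =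
      ≈-trans (value (lookup lv i) ≡.refl) (≡⇒≈P (≡.cong (shift a) (≡.sym (lookup-map i leafExpr lv))))
      where
      value : ∀ l → lookup lv i ≡ l → child vals′ st (translateLeaf l i) ≈P shift a (leafExpr l)
      value yleaf     _  = y+a
      value (xleaf _) eq = leaf′-value (≡.trans (lookup-oldLeaf i) eq)
      value (cleaf _) eq = leaf′-value (≡.trans (lookup-oldLeaf i) eq)

    translateChild-value : ∀ {k} (pr : Fin k → Fin m′ ⊎ Fin K) st prev a →
      lookup st yNode ≈P yv ⊕ cst a → Realises pr st prev a →
      ∀ ch → child vals′ st (translateChild pr ch) ≈P shift a (child vals prev ch)
    translateChild-value pr st prev a y+a realises (inj₁ i) = translateLeaf-realises st a y+a i
    translateChild-value pr st prev a y+a realises (inj₂ u) = realises u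

    translateGate-value : ∀ {k} (pr : Fin k → Fin m′ ⊎ Fin K) st prev a →
      lookup st yNode ≈P yv ⊕ cst a → Realises pr st prev a →
      ∀ g → gateExpr vals′ st (translateGate pr g) ≈P shift a (gateExpr vals prev g)
    translateGate-value pr st prev a y+a realises (gate plus l r) =
      ⊕-cong (translateChild-value pr st prev a y+a realises l) (translateChild-value pr st prev a y+a realises r)
    translateGate-value pr st prev a y+a realises (gate times l r) =
      ⊗-cong (translateChild-value pr st prev a y+a realises l) (translateChild-value pr st prev a y+a realises r)

    -- A copy u × 1 reads its 1 from a leaf, which is not y, so it stays a copy.
    translateGate-isCopy : ∀ {k} (ρ : Fin k → Fin K) g → IsCopy lv g → IsCopy lv′ (translateGate (inj₂ ∘ ρ) g)
    translateGate-isCopy ρ (gate .times .(inj₂ u) .(inj₁ i))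
                         (≡.refl , inj₁ (u , i , ≡.refl , ≡.refl , (v , lv[i]≡v , v≈1))) rewrite lv[i]≡v =
      ≡.refl , inj₁ (ρ u , oldLeaf i , ≡.refl , ≡.refl , (v , ≡.trans (lookup-oldLeaf i) lv[i]≡v , v≈1))
    translateGate-isCopy ρ (gate .times .(inj₁ i) .(inj₂ u))
                         (≡.refl , inj₂ (u , i , ≡.refl , ≡.refl , (v , lv[i]≡v , v≈1))) rewrite lv[i]≡v =
      ≡.refl , inj₂ (ρ u , oldLeaf i , ≡.refl , ≡.refl , (v , ≡.trans (lookup-oldLeaf i) lv[i]≡v , v≈1))

  open Translate

  shiftedLayer : ∀ {K k k′} (sNode yNode : Fin K) → (Fin k → Fin K) → Vec (Gate m k) k′ → Vec (Gate m′ K) (2 + k′)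
  shiftedLayer sNode yNode ρ g = copy sNode ∷ copy yNode ∷ map (translateGate yNode (inj₂ ∘ ρ)) g

  shiftedLayer-staggered : ∀ {K k k′} (sNode yNode : Fin K) (ρ : Fin k → Fin K) (g : Vec (Gate m k) k′) →
                           StaggeredLayer lv g → StaggeredLayer lv′ (shiftedLayer sNode yNode ρ g)
  shiftedLayer-staggered sNode yNode ρ g stag fzero _ ¬c _ = ⊥-elim (¬c (copy-isCopy sNode))
  shiftedLayer-staggered sNode yNode ρ g stag (fsuc fzero) _ ¬c _ = ⊥-elim (¬c (copy-isCopy yNode))
  shiftedLayer-staggered sNode yNode ρ g stag (fsuc (fsuc i)) fzero _ ¬c = ⊥-elim (¬c (copy-isCopy sNode))
  shiftedLayer-staggered sNode yNode ρ g stag (fsuc (fsuc i)) (fsuc fzero) _ ¬c = ⊥-elim (¬c (copy-isCopy yNode))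
  shiftedLayer-staggered sNode yNode ρ g stag (fsuc (fsuc i)) (fsuc (fsuc j)) ¬ci ¬cj =
    ≡.cong (fsuc ∘ fsuc) (stag i j (¬copy i ¬ci) (¬copy j ¬cj))
    where
    ¬copy : ∀ i → ¬ IsCopy lv′ (lookup (map (translateGate yNode (inj₂ ∘ ρ)) g) i) → ¬ IsCopy lv (lookup g i)
    ¬copy i ¬c c = ¬c (≡.subst (IsCopy lv′) (≡.sym (lookup-map i _ g)) (translateGate-isCopy yNode ρ _ c))

  shiftedLayer-gate : ∀ {K k k′} (sNode yNode : Fin K) (ρ : Fin k → Fin K) (g : Vec (Gate m k) k′) st prev a →
    lookup st yNode ≈P yv ⊕ cst a → Realises yNode (inj₂ ∘ ρ) st prev a → ∀ u →
    lookup (map (gateExpr vals′ st) (shiftedLayer sNode yNode ρ g)) (fsuc (fsuc u)) ≈P shift a (lookup (map (gateExpr vals prev) g) u)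
  shiftedLayer-gate sNode yNode ρ g st prev a y+a realises u = begin
    lookup (map (gateExpr vals′ st) (map (translateGate yNode (inj₂ ∘ ρ)) g)) u
      ≡⟨ ≡.trans (lookup-map u _ (map _ g)) (≡.cong (gateExpr vals′ st) (lookup-map u _ g)) ⟩
    gateExpr vals′ st (translateGate yNode (inj₂ ∘ ρ) (lookup g u))
      ≈⟨ translateGate-value yNode (inj₂ ∘ ρ) st prev a y+a realises (lookup g u) ⟩
    shift a (gateExpr vals prev (lookup g u))
      ≡⟨ ≡.cong (shift a) (≡.sym (lookup-map u _ g)) ⟩
    shift a (lookup (map (gateExpr vals prev) g) u) ∎

  -- Translating the first layer in one go would turn its copies of x-leaves into non-copies,
  -- so its gates are computed one per layer while everything else is copied along.
  firstLayerStep : ∀ {K} (yNode : Fin K) → Gate m m → Vec (Gate m′ K) (suc K)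
  firstLayerStep yNode g = translateGate yNode (λ i → translateLeaf yNode (lookup lv i) i) g ∷ tabulate copy

  firstLayerStep-staggered : ∀ {K} (yNode : Fin K) g → StaggeredLayer lv′ (firstLayerStep yNode g)
  firstLayerStep-staggered yNode g = staggeredLayer-copiesBut lv′ (firstLayerStep yNode g) fzero copies
    where
    copies : ∀ q → q ≢ fzero → IsCopy lv′ (lookup (firstLayerStep yNode g) q)
    copies fzero    0≢0 = ⊥-elim (0≢0 ≡.refl)
    copies (fsuc q) _   = ≡.subst (IsCopy lv′) (≡.sym (lookup∘tabulate copy q)) (copy-isCopy q)

  firstLayerStep-gate : ∀ {K} (yNode : Fin K) g st a → lookup st yNode ≈P yv ⊕ cst a →
    lookup (map (gateExpr vals′ st) (firstLayerStep yNode g)) fzero ≈P shift a (gateExpr vals vals g)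
  firstLayerStep-gate yNode g st a y+a =
    translateGate-value yNode _ st vals a y+a (translateLeaf-realises yNode st a y+a) g

  firstLayerStep-keep : ∀ {K} (yNode : Fin K) g st q →
    lookup (map (gateExpr vals′ st) (firstLayerStep yNode g)) (fsuc q) ≈P lookup st q
  firstLayerStep-keep yNode g st q = ≈-trans
    (≡⇒≈P (≡.trans (lookup-map q _ (tabulate copy)) (≡.cong (gateExpr vals′ st) (lookup∘tabulate copy q))))
    (copy-value st q)

  record Serialisation (K k′ : ℕ) : Set where
    field
      {K′}     : ℕ
      segment  : Segment m′ K K′
      keep     : Fin K → Fin K′
      gateNode : Fin k′ → Fin K′
  open Serialisation

  serialise : ∀ {K k′} (yNode : Fin K) → Vec (Gate m m) k′ → Serialisation K k′
  serialise yNode []       = record { segment = [] ; keep = λ q → q ; gateNode = λ () }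
  serialise {K} {suc k′} yNode (g ∷ gs) = record
    { segment  = firstLayerStep yNode g ∷ segment rest
    ; keep     = keep rest ∘ fsuc
    ; gateNode = λ { fzero → keep rest fzero ; (fsuc u) → gateNode rest u }
    }
    where
    rest : Serialisation (suc K) k′
    rest = serialise (fsuc yNode) gs

  serialise-staggered : ∀ {K k′} (yNode : Fin K) (g : Vec (Gate m m) k′) → Staggeredˢ lv′ (segment (serialise yNode g))
  serialise-staggered yNode []       = _
  serialise-staggered yNode (g ∷ gs) = firstLayerStep-staggered yNode g , serialise-staggered (fsuc yNode) gs

  serialise-depth : ∀ {K k′} (yNode : Fin K) (g : Vec (Gate m m) k′) → depth (segment (serialise yNode g)) ≡ k′
  serialise-depth yNode []       = ≡.refl
  serialise-depth yNode (g ∷ gs) = ≡.cong suc (serialise-depth (fsuc yNode) gs)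

  serialise-narrow : ∀ {K k′} W (yNode : Fin K) (g : Vec (Gate m m) k′) → K + k′ ≤ W →
                     WidthAtMost W (segment (serialise yNode g))
  serialise-narrow W yNode []       _ = _
  serialise-narrow {K} {suc k′} W yNode (g ∷ gs) K+k′≤W =
    ≤-trans (m≤m+n (suc K) k′) 1+K+k′≤W , serialise-narrow W (fsuc yNode) gs 1+K+k′≤W
    where
    1+K+k′≤W : suc K + k′ ≤ W
    1+K+k′≤W = ≡.subst (_≤ W) (+-suc K k′) K+k′≤W

  serialise-keep : ∀ {K k′} (yNode : Fin K) (g : Vec (Gate m m) k′) st q → let s = serialise yNode g in
    lookup (evalˢ vals′ st (segment s)) (keep s q) ≈P lookup st q
  serialise-keep yNode []       st q = ≈-refl
  serialise-keep yNode (g ∷ gs) st q =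
    ≈-trans (serialise-keep (fsuc yNode) gs _ (fsuc q)) (firstLayerStep-keep yNode g st q)

  serialise-gate : ∀ {K k′} (yNode : Fin K) (g : Vec (Gate m m) k′) st a → lookup st yNode ≈P yv ⊕ cst a →
    ∀ u → let s = serialise yNode g in
    lookup (evalˢ vals′ st (segment s)) (gateNode s u) ≈P shift a (lookup (map (gateExpr vals vals) g) u)
  serialise-gate yNode (g ∷ gs) st a y+a fzero    =
    ≈-trans (serialise-keep (fsuc yNode) gs _ fzero) (firstLayerStep-gate yNode g st a y+a)
  serialise-gate yNode (g ∷ gs) st a y+a (fsuc u) =
    serialise-gate (fsuc yNode) gs _ a (≈-trans (firstLayerStep-keep yNode g st yNode) y+a) u

  -- In the new circuit, sNode holds the running sum Σ μᵢ P(x, y + αᵢ) over the rounds done so far.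
  record Adder (K : ℕ) (G : Vec Expr K → Set (c ⊔ ℓ)) (sNode : Fin K) (d W : ℕ) (T : Expr) : Set (c ⊔ ℓ) where
    field
      segment   : Segment m′ K 1
      staggered : Staggeredˢ lv′ segment
      shallow   : depth segment ≤ d
      narrow    : WidthAtMost W segment
      adds      : ∀ st → G st → lookup (evalˢ vals′ st segment) fzero ≈P lookup st sNode ⊕ T

  prependˢ : ∀ {K K₁ G G′ sNode sNode′ d d′ W T} (s : Segment m′ K K₁) →
    Staggeredˢ lv′ s → WidthAtMost W s → depth s + d ≤ d′ →
    (∀ st → G st → G′ (evalˢ vals′ st s) × lookup (evalˢ vals′ st s) sNode′ ≈P lookup st sNode) →
    Adder K₁ G′ sNode′ d W T → Adder K G sNode d′ W T
  prependˢ s stag narrow deep pre a = record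
    { segment   = s ++ˢ A.segment
    ; staggered = staggered-++ lv′ s A.segment stag A.staggered
    ; shallow   = ≤-trans (≡.subst (_≤ _) (≡.sym (depth-++ s A.segment)) (+-monoʳ-≤ (depth s) A.shallow)) deep
    ; narrow    = widthAtMost-++ _ s A.segment narrow A.narrow
    ; adds      = λ st g → ≈-trans (≡⇒≈P (≡.cong (λ v → lookup v fzero) (evalˢ-++ vals′ st s A.segment)))
                           (≈-trans (A.adds _ (proj₁ (pre st g))) (⊕-cong (proj₂ (pre st g)) ≈-refl))
    }
    where module A = Adder a

  noAdder : ∀ {W} → Adder 1 (λ _ → ⊤) fzero 0 W (cst 0#)
  noAdder = record { segment = [] ; staggered = _ ; shallow = z≤n ; narrow = _ ; adds = λ st _ → ≈-sym (⊕-identityʳ _) }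

  _then_ : ∀ {K G sNode d₁ d₂ W T₁ T₂} → Adder K G sNode d₁ W T₁ → Adder 1 (λ _ → ⊤) fzero d₂ W T₂ →
           Adder K G sNode (d₁ + d₂) W (T₁ ⊕ T₂)
  a then b = record
    { segment   = A.segment ++ˢ B.segment
    ; staggered = staggered-++ lv′ A.segment B.segment A.staggered B.staggered
    ; shallow   = ≡.subst (_≤ _) (≡.sym (depth-++ A.segment B.segment)) (+-mono-≤ A.shallow B.shallow)
    ; narrow    = widthAtMost-++ _ A.segment B.segment A.narrow B.narrow
    ; adds      = λ st g → ≈-trans (≡⇒≈P (≡.cong (λ v → lookup v fzero) (evalˢ-++ vals′ st A.segment B.segment)))
                           (≈-trans (B.adds _ _) (≈-trans (⊕-cong (A.adds st g) ≈-refl) (⊕-assoc _ _ _)))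
    }
    where
    module A = Adder a
    module B = Adder b

  sumAdders : ∀ {R′ d W} (T : Fin R′ → Expr) → (∀ k → Adder 1 (λ _ → ⊤) fzero d W (T k)) →
              Adder 1 (λ _ → ⊤) fzero (R′ * d) W (ΣE.sum T)
  sumAdders {zero}  T adders = noAdder
  sumAdders {suc R′} T adders = adders fzero then sumAdders (T ∘ fsuc) (adders ∘ fsuc)

  accumulate : ∀ {K W} (i : Fin R) (sNode : Fin K) (out : Fin m′ ⊎ Fin K) X → 2 ≤ W →
               Adder K (λ st → child vals′ st out ≈P X) sNode 2 W (cst (μ i) ⊗ X)
  accumulate {K} i sNode out X 2≤W = record
    { segment   = products ∷ (sum ∷ []) ∷ []
    ; staggered = staggeredLayer-copiesBut lv′ products (fsuc fzero) copies , staggeredLayer-single lv′ sum , _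
    ; shallow   = ≤-refl
    ; narrow    = 2≤W , ≤-trans (s≤s z≤n) 2≤W , _
    ; adds      = λ st out≈X → ⊕-cong (copy-value st sNode) (⊗-cong (μLeaf-value i) out≈X)
    }
    where
    products : Vec (Gate m′ K) 2
    products = copy sNode ∷ gate times (inj₁ (μLeaf i)) out ∷ []
    sum : Gate m′ 2
    sum = gate plus (inj₂ fzero) (inj₂ (fsuc fzero))
    copies : ∀ q → q ≢ fsuc fzero → IsCopy lv′ (lookup products q)
    copies fzero        _   = copy-isCopy sNode
    copies (fsuc fzero) 1≢1 = ⊥-elim (1≢1 ≡.refl)

  ShiftedState : ∀ {K k} → Carrier → Fin K → (Fin k → Fin K) → Vec Expr k → Vec Expr K → Set (c ⊔ ℓ)
  ShiftedState a yNode ρ prev st = lookup st yNode ≈P yv ⊕ cst a × Realises yNode (inj₂ ∘ ρ) st prev a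

  -- Empty layers of the old circuit are skipped, so that the depth is bounded by its size.
  shiftedTail : ∀ {K k w} (i : Fin R) {P} (sNode yNode : Fin K) (ρ : Fin k → Fin K) (gs : Layers m k) prev →
    StaggeredLayers lv gs → layersWidth gs ≤ w → LayersCompute vals prev gs P →
    Adder K (ShiftedState (α i) yNode ρ prev) sNode (2 + layersSize gs) (2 + w) (cst (μ i) ⊗ shift (α i) P)
  shiftedTail i sNode yNode ρ [] prev _ _ ()
  shiftedTail i sNode yNode ρ (_∷_ {k' = zero} g gs) prev _ _ (inj₁ (() , _))
  shiftedTail i sNode yNode ρ (_∷_ {k' = zero} g gs) prev (_ , stag) width (inj₂ lc) =
    prependˢ [] _ _ ≤-refl (λ { st (y+a , _) → (y+a , λ ()) , ≈-refl })
             (shiftedTail i sNode yNode (λ ()) gs _ stag width lc)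
  shiftedTail {w = w} i {P} sNode yNode ρ (_∷_ {k' = suc k′} g gs) prev (stag-g , stag) width (inj₁ (p , h)) =
    prependˢ (shiftedLayer sNode yNode ρ g ∷ []) (shiftedLayer-staggered sNode yNode ρ g stag-g , _)
             (+-monoʳ-≤ 2 (≤-trans (m≤m⊔n (suc k′) (layersWidth gs)) width) , _) (s≤s (s≤s (s≤s z≤n)))
             (λ { st (y+a , realises) →
                    ≈-trans (shiftedLayer-gate sNode yNode ρ g st prev (α i) y+a realises p) (shift-cong (α i) h)
                  , copy-value st sNode })
             (accumulate i fzero (inj₂ (fsuc (fsuc p))) (shift (α i) P) (m≤m+n 2 w))
  shiftedTail {w = w} i sNode yNode ρ (_∷_ {k' = suc k′} g gs) prev (stag-g , stag) width (inj₂ lc) =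
    prependˢ (shiftedLayer sNode yNode ρ g ∷ []) (shiftedLayer-staggered sNode yNode ρ g stag-g , _)
             (+-monoʳ-≤ 2 (≤-trans (m≤m⊔n (suc k′) (layersWidth gs)) width) , _) (s≤s (s≤s (s≤s (m≤n+m _ k′))))
             (λ { st (y+a , realises) →
                    (≈-trans (copy-value st yNode) y+a , shiftedLayer-gate sNode yNode ρ g st prev (α i) y+a realises)
                  , copy-value st sNode })
             (shiftedTail i fzero (fsuc fzero) (fsuc ∘ fsuc) gs _ stag (≤-trans (m≤n⊔m (suc k′) (layersWidth gs)) width) lc)

  startLayer : Fin R → Vec (Gate m′ 1) 2
  startLayer i = copy fzero ∷ gate plus (inj₁ yLeaf) (inj₁ (αLeaf i)) ∷ []

  firstLayer : ∀ {k′} → Vec (Gate m m) k′ → Serialisation 2 k′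
  firstLayer = serialise (fsuc fzero)

  opening : ∀ {k′} → Fin R → (g : Vec (Gate m m) k′) → Segment m′ 1 (K′ (firstLayer g))
  opening i g = startLayer i ∷ segment (firstLayer g)

  opening-staggered : ∀ {k′} i (g : Vec (Gate m m) k′) → Staggeredˢ lv′ (opening i g)
  opening-staggered i g = staggeredLayer-copiesBut lv′ (startLayer i) (fsuc fzero) copies , serialise-staggered (fsuc fzero) g
    where
    copies : ∀ q → q ≢ fsuc fzero → IsCopy lv′ (lookup (startLayer i) q)
    copies fzero        _   = copy-isCopy fzero
    copies (fsuc fzero) 1≢1 = ⊥-elim (1≢1 ≡.refl)

  opening-depth : ∀ {k′} i (g : Vec (Gate m m) k′) → depth (opening i g) ≡ suc k′
  opening-depth i g = ≡.cong suc (serialise-depth (fsuc fzero) g)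

  opening-narrow : ∀ {k′} W i (g : Vec (Gate m m) k′) → 2 + k′ ≤ W → WidthAtMost W (opening i g)
  opening-narrow W i g 2+k′≤W = ≤-trans (m≤m+n 2 _) 2+k′≤W , serialise-narrow W (fsuc fzero) g 2+k′≤W

  opening-value : ∀ {k′} i (g : Vec (Gate m m) k′) st → let s = firstLayer g ; out = evalˢ vals′ st (opening i g) in
      lookup out (keep s fzero) ≈P lookup st fzero
    × ShiftedState (α i) (keep s (fsuc fzero)) (gateNode s) (map (gateExpr vals vals) g) out
  opening-value i g st =
      ≈-trans (serialise-keep (fsuc fzero) g st₁ fzero) (copy-value st fzero)
    , ≈-trans (serialise-keep (fsuc fzero) g st₁ (fsuc fzero)) y+α
    , serialise-gate (fsuc fzero) g st₁ (α i) y+α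
    where
    st₁ : Vec Expr 2
    st₁ = map (gateExpr vals′ st) (startLayer i)
    y+α : lookup st₁ (fsuc fzero) ≈P yv ⊕ cst (α i)
    y+α = ⊕-cong yLeaf-value (αLeaf-value i)

  round : ∀ {w} (i : Fin R) {P} (ls : Layers m m) → StaggeredLayers lv ls → layersWidth ls ≤ w →
          Computes (circuit m lv ls) P →
          Adder 1 (λ _ → ⊤) fzero (3 + layersSize ls) (2 + w) (cst (μ i) ⊗ shift (α i) P)
  round {w} i {P} ls _ _ (inj₁ (q , h)) =
    prependˢ (opening i []) (opening-staggered i []) (opening-narrow (2 + w) i [] (m≤m+n 2 w)) (s≤s (s≤s (s≤s z≤n)))
             (λ st _ → let keep₀ , y+α , _ = opening-value i [] st in
                       ≈-trans (translateLeaf-realises (fsuc fzero) _ (α i) y+α q) (shift-cong (α i) h) , keep₀)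
             (accumulate i fzero (translateLeaf (fsuc fzero) (lookup lv q) q) (shift (α i) P) (m≤m+n 2 w))
  round i [] _ _ (inj₂ ())
  round {w} i {P} (_∷_ {k' = k′} g gs) (_ , stag) width (inj₂ (inj₁ (p , h))) =
    prependˢ (opening i g) (opening-staggered i g)
             (opening-narrow (2 + w) i g (+-monoʳ-≤ 2 (≤-trans (m≤m⊔n k′ (layersWidth gs)) width)))
             (≡.subst (_≤ 3 + (k′ + layersSize gs)) (≡.cong (_+ 2) (≡.sym (opening-depth i g))) deep)
             (λ st _ → let keep₀ , _ , gates = opening-value i g st in ≈-trans (gates p) (shift-cong (α i) h) , keep₀)
             (accumulate i (keep (firstLayer g) fzero) (inj₂ (gateNode (firstLayer g) p)) (shift (α i) P) (m≤m+n 2 w))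
    where
    deep : suc k′ + 2 ≤ 3 + (k′ + layersSize gs)
    deep = ≡.subst (_≤ 3 + (k′ + layersSize gs)) (+-comm 2 (suc k′)) (+-monoʳ-≤ 3 (m≤m+n k′ _))
  round {w} i (_∷_ {k' = k′} g gs) (_ , stag) width (inj₂ (inj₂ lc)) =
    prependˢ (opening i g) (opening-staggered i g)
             (opening-narrow (2 + w) i g (+-monoʳ-≤ 2 (≤-trans (m≤m⊔n k′ (layersWidth gs)) width)))
             (≡.subst (_≤ 3 + (k′ + layersSize gs)) (≡.cong (_+ (2 + layersSize gs)) (≡.sym (opening-depth i g))) deep)
             (λ st _ → swap (opening-value i g st))
             (shiftedTail i (keep (firstLayer g) fzero) (keep (firstLayer g) (fsuc fzero)) (gateNode (firstLayer g)) gs _ stag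
                          (≤-trans (m≤n⊔m k′ (layersWidth gs)) width) lc)
    where
    deep : suc k′ + (2 + layersSize gs) ≤ 3 + (k′ + layersSize gs)
    deep = s≤s (≤-reflexive (≡.trans (+-suc k′ (suc (layersSize gs))) (≡.cong suc (+-suc k′ (layersSize gs)))))

  rounds : ∀ {w P} (ls : Layers m m) → StaggeredLayers lv ls → layersWidth ls ≤ w → Computes (circuit m lv ls) P →
           Adder 1 (λ _ → ⊤) fzero (R * (3 + layersSize ls)) (2 + w) (shiftCombination μ α P)
  rounds {P = P} ls stag width computes =
    sumAdders (λ i → cst (μ i) ⊗ shift (α i) P) (λ i → round i ls stag width computes)

  zeroLayer : Vec (Gate m′ m′) 1
  zeroLayer = gate times (inj₁ zeroLeaf) (inj₁ oneLeaf) ∷ []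

  adderCircuit : ∀ {d W T} → Adder 1 (λ _ → ⊤) fzero d W T → Circuit
  adderCircuit a = circuit m′ lv′ (zeroLayer ∷ toLayers (Adder.segment a))

  module _ {d W T} (a : Adder 1 (λ _ → ⊤) fzero d W T) where
    private module A = Adder a

    adderCircuit-staggered : Staggered (adderCircuit a)
    adderCircuit-staggered = staggeredLayer-single lv′ (lookup zeroLayer fzero) , A.staggered

    adderCircuit-width : 1 ≤ W → width (adderCircuit a) ≤ W
    adderCircuit-width 1≤W = ⊔-lub 1≤W (layersWidth-toLayers W A.segment A.narrow)

    adderCircuit-size : size (adderCircuit a) ≤ m′ + (1 + d * W)
    adderCircuit-size = +-monoʳ-≤ m′ (s≤s (≤-trans (layersSize-toLayers W A.segment A.narrow) (*-monoˡ-≤ W A.shallow)))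

    adderCircuit-computes : ∀ {Q} → T ≈P Q → Computes (adderCircuit a) Q
    adderCircuit-computes {Q} T≈Q = inj₂ (layersCompute-last vals′ vals′ zeroLayer A.segment _ fzero (begin
      lookup (evalˢ vals′ (map (gateExpr vals′ vals′) zeroLayer) A.segment) fzero
        ≈⟨ A.adds _ _ ⟩
      lookup vals′ zeroLeaf ⊗ lookup vals′ oneLeaf ⊕ T
        ≈⟨ ⊕-cong (⊗-cong zeroLeaf-value oneLeaf-value) T≈Q ⟩
      cst 0# ⊗ cst 1# ⊕ Q
        ≈⟨ ⊕-cong (⊗-identityʳ _) ≈-refl ⟩
      cst 0# ⊕ Q
        ≈⟨ ⊕-idˡ Q ⟩
      Q ∎))


module SizeArithmetic where

  open import Data.Nat using (ℕ; _+_; _*_; _^_; _≤_; s≤s; z≤n; >-nonZero)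
  open import Data.Nat.Properties
  open import Data.Nat.Solver using (module +-*-Solver)
  open import Relation.Binary.PropositionalEquality as ≡ using (_≡_)
  open +-*-Solver using (solve; _:=_; _:+_; _:*_; con)
  open ≤-Reasoning

  square≤^19 : ∀ N → 1 ≤ N → N * N ≤ N ^ 19
  square≤^19 N 1≤N =
    *-monoʳ-≤ N (≡.subst (_≤ N ^ 18) (*-identityʳ N) (^-monoʳ-≤ N ⦃ >-nonZero 1≤N ⦄ {1} {18} (s≤s z≤n)))

  size-bound : ∀ R m LS w → 1 ≤ R → 1 ≤ m + LS → w ≤ LS →
               m + (3 + (R + R)) + (1 + R * (3 + LS) * (2 + w)) ≤ 19 * (R * (m + LS)) ^ 19
  size-bound R m LS w 1≤R 1≤s w≤LS = begin
    m + (3 + (R + R)) + (1 + R * (3 + LS) * (2 + w))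
      ≤⟨ +-mono-≤ (+-mono-≤ m≤N (+-mono-≤ (*-monoʳ-≤ 3 1≤N) (+-mono-≤ R≤N R≤N)))
                  (+-mono-≤ 1≤N (*-mono-≤ R*[3+LS]≤3N+N (+-monoʳ-≤ 2 w≤N))) ⟩
    N + (3 * N + (N + N)) + (N + (3 * N + N) * (2 + N))
      ≡⟨ solve 1 (λ N → N :+ (con 3 :* N :+ (N :+ N)) :+ (N :+ (con 3 :* N :+ N) :* (con 2 :+ N))
                        := con 15 :* N :+ con 4 :* (N :* N)) ≡.refl N ⟩
    15 * N + 4 * (N * N)
      ≤⟨ +-monoˡ-≤ (4 * (N * N)) (*-monoʳ-≤ 15 (m≤m*n N N ⦃ >-nonZero 1≤N ⦄)) ⟩
    15 * (N * N) + 4 * (N * N)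
      ≡⟨ ≡.sym (*-distribʳ-+ (N * N) 15 4) ⟩
    19 * (N * N)
      ≤⟨ *-monoʳ-≤ 19 (square≤^19 N 1≤N) ⟩
    19 * N ^ 19 ∎
    where
    N : ℕ
    N = R * (m + LS)
    s≤N : m + LS ≤ N
    s≤N = ≡.subst (_≤ N) (*-identityˡ (m + LS)) (*-monoˡ-≤ (m + LS) 1≤R)
    1≤N : 1 ≤ N
    1≤N = ≤-trans 1≤s s≤N
    m≤N : m ≤ N
    m≤N = ≤-trans (m≤m+n m LS) s≤N
    w≤N : w ≤ N
    w≤N = ≤-trans w≤LS (≤-trans (m≤n+m LS m) s≤N)
    R≤N : R ≤ N
    R≤N = ≡.subst (_≤ N) (*-identityʳ R) (*-monoʳ-≤ R 1≤s)
    R*[3+LS]≤3N+N : R * (3 + LS) ≤ 3 * N + N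
    R*[3+LS]≤3N+N = begin
      R * (3 + LS)     ≡⟨ *-distribˡ-+ R 3 LS ⟩
      R * 3 + R * LS   ≤⟨ +-mono-≤ (≡.subst (_≤ 3 * N) (*-comm 3 R) (*-monoʳ-≤ 3 R≤N)) (*-monoʳ-≤ R (m≤n+m LS m)) ⟩
      3 * N + N        ∎

open import Data.Nat using (suc; _+_; _*_; _^_; _≤_; z≤n; s≤s)
import Data.Nat.Properties as ℕₚ
open import Data.Product using (Σ; _×_; _,_; proj₁; proj₂)
open import Data.Unit.Polymorphic using (⊤)
open import Relation.Binary.PropositionalEquality using (_≡_; refl)

module _ {c ℓ} (F : Field c ℓ) (n : ℕ) where
  open Field F using (Carrier; _≈_)
  open Poly F n
  open LayeredCircuits F n using (layersWidth≤layersSize; computes⇒1≤size)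
  open Derivatives F n using (Moments; derivativeMoment; shiftCombination; shiftCombination≈∂y^)

  ∂y^-staggeredCircuit : ∀ r (α : Fin (suc r) → Carrier) → (∀ i k → α i ≈ α k → i ≡ k) →
    ∀ C {P} → Staggered C → Computes C P → DegY P r → ∀ j →
    Σ Circuit λ C′ → Staggered C′ × width C′ ≤ 2 + width C × size C′ ≤ 19 * (suc r * size C) ^ 19
                   × Computes C′ (∂y^ j P)
  ∂y^-staggeredCircuit r α distinct (circuit m lv ls) {P} stag computes deg j =
      adderCircuit adder
    , adderCircuit-staggered adder
    , adderCircuit-width adder (s≤s z≤n)
    , ℕₚ.≤-trans (adderCircuit-size adder)
                 (SizeArithmetic.size-bound (suc r) m (layersSize ls) (layersWidth ls) (s≤s z≤n)
                                            (computes⇒1≤size (circuit m lv ls) computes) (layersWidth≤layersSize ls))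
    , adderCircuit-computes adder (shiftCombination≈∂y^ μ α j r deg moments)
    where
    solution : Σ (Fin (suc r) → Carrier) λ μ → Moments μ α j r
    solution = Vandermonde.vandermonde-solvable F r α distinct (derivativeMoment j)
    μ : Fin (suc r) → Carrier
    μ = proj₁ solution
    moments : Moments μ α j r
    moments = proj₂ solution
    open ShiftCircuit F n m lv α μ
    adder : Adder 1 (λ _ → ⊤) Data.Fin.zero (suc r * (3 + layersSize ls)) (2 + layersWidth ls) (shiftCombination μ α P)
    adder = rounds ls stag ℕₚ.≤-refl computes

lemma5 : ∀ {c ℓ} →
    Σ ℕ λ a → Σ (ℕ → ℕ → ℕ) λ L →
    (F : Field c ℓ) (n r s w : ℕ) →
    HasAtLeast F (L r s) →
    (C : Poly.Circuit F n) (P : Poly.Expr F n) →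
    Poly.Staggered F n C →
    Poly.width F n C ≡ w →
    Poly.size F n C ≡ s →
    Poly.Computes F n C P →
    Poly.DegY F n P r →
    (j : ℕ) →
    Σ (Poly.Circuit F n) λ C' →
        Poly.Staggered F n C'
      × Poly.width F n C' ≤ w + a
      × Poly.size F n C' ≤ a * (suc r * s) ^ a
      × Poly.Computes F n C' (Poly.∂y^ F n j P)
lemma5 = 19 , (λ r _ → suc r) , λ where
  F n r _ w (α , distinct) C P stag refl refl computes deg j →
    let C′ , stag′ , width′ , size′ , computes′ = ∂y^-staggeredCircuit F n r α distinct C stag computes deg j
    in C′ , stag′ , ℕₚ.≤-trans width′ (ℕₚ.≤-trans (ℕₚ.≤-reflexive (ℕₚ.+-comm 2 w)) (ℕₚ.+-monoʳ-≤ w (ℕₚ.m≤m+n 2 17)))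
     , size′ , computes′
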